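{- Let $T_n$ be the Tamari lattice and let $I$ be any interval of $T_n$. Suppose $I$ has $k$ atoms, let $\rho(x)$ be the number of atoms of $I$ below $x$ (for $x\in I$), and let $m$ be the length of the longest chain in $I$. Then the characteristic polynomial of $I$ with respect to $\rho$ and $m$ is $$\chi(I,t)=t^{m-k}(t-1)^k.$$
   Context: The Tamari lattice $T_n$ is the set of (complete binary) parenthesizations of the word $x_1x_2\cdots x_{n+1}$, ordered by the covering relation: $\pi$ is covered by $\sigma$ if there are subwords $A,B,C$ with $\pi=\cdots((AB)C)\cdots$ and $\sigma=\cdots(A(BC))\cdots$. For an interval $I=[u,v]$, the Möbius function is $\mu(x)=\mu(u,x)$ (i.e. $\sum_{u\le y\le x}\mu(y)=\delta_{u,x}$), and the characteristic polynomial with respect to $\rho$ and $m$ is $\chi(I,t)=\sum_{x\in I}\mu(x)t^{m-\rho(x)}$. (Here $\rho$ is the generalized rank for the partition of the atoms of $I$ into singleton blocks: the generalized rank for an ordered partition $(A_1,\dots,A_n)$ of the atoms is the number of blocks containing an atom below $x$.) -}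

module Defs where

open import Data.Nat using (ℕ; suc; _+_; _≤_)
open import Data.Integer using (ℤ; +_) renaming (_+_ to _+ℤ_)
open import Data.List using (List; []; _∷_; length; filter; map)
open import Data.List.Relation.Unary.All using (All)
open import Data.List.Relation.Unary.Unique.Propositional using (Unique)
open import Data.List.Relation.Unary.Linked using (Linked)
open import Data.List.Membership.Propositional using (_∈_)
open import Data.Product using (_×_; Σ)
open import Data.Empty using (⊥)
open import Relation.Nullary using (¬_)
open import Relation.Binary using (Decidable)
open import Relation.Binary.PropositionalEquality using (_≡_; _≢_)
open import Relation.Binary.Construct.Closure.ReflexiveTransitive using (Star)
open import Function.Bundles using (_⇔_)

-- Complete binary parenthesizations (binary trees); leaves = letters x_i.
data Bin : Set where
  leaf : Bin
  node : Bin → Bin → Bin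

leaves : Bin → ℕ
leaves leaf       = 1
leaves (node s t) = leaves s + leaves t

InT : ℕ → Bin → Set
InT n t = leaves t ≡ suc n

data _⋖_ : Bin → Bin → Set where
  rot : ∀ a b c → node (node a b) c ⋖ node a (node b c)
  inl : ∀ {s s'} t → s ⋖ s' → node s t ⋖ node s' t
  inr : ∀ s {t t'} → t ⋖ t' → node s t ⋖ node s t'

_≤T_ : Bin → Bin → Set
_≤T_ = Star _⋖_

_<T_ : Bin → Bin → Set
x <T y = x ≤T y × x ≢ y

InI : Bin → Bin → Bin → Set
InI u v x = u ≤T x × x ≤T v

IsAtom : Bin → Bin → Bin → Set
IsAtom u v x = InI u v x × u <T x × (∀ y → u <T y → y <T x → ⊥)

IsChainIn : Bin → Bin → List Bin → Set
IsChainIn u v c = All (InI u v) c × Linked _<T_ c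

IsLongestChainLength : Bin → Bin → ℕ → Set
IsLongestChainLength u v m =
  Σ (List Bin) (λ c → IsChainIn u v c × length c ≡ suc m)
  × (∀ c → IsChainIn u v c → length c ≤ suc m)

Enumerates : (Bin → Set) → List Bin → Set
Enumerates P L = Unique L × (∀ x → (x ∈ L) ⇔ P x)

sumℤ : List ℤ → ℤ
sumℤ []       = + 0
sumℤ (x ∷ xs) = x +ℤ sumℤ xs

module _ (dec : Decidable _≤T_) where

  below : List Bin → Bin → List Bin
  below L x = filter (λ y → dec y x) L

  IsMobius : Bin → Bin → List Bin → (Bin → ℤ) → Set
  IsMobius u v L μ =
    sumℤ (map μ (below L u)) ≡ + 1
    × (∀ x → InI u v x → x ≢ u → sumℤ (map μ (below L x)) ≡ + 0)

  ρ : List Bin → Bin → ℕ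
  ρ A x = length (below A x)

-- Bracket vectors (Huang–Tamari) embed the trees of a given size into ℕⁿ so that the Tamari order
-- becomes the componentwise order and joins become componentwise maxima.  A covering rotation
-- changes a single coordinate, so an atom of I below x ∨ y is below x or below y.  Hence, for every
-- set E of atoms, the elements of I all of whose atoms lie in E have a greatest element, which is u
-- exactly when E is empty; their Möbius sum is therefore [E = ∅].  Writing t^(k - ρ(x)) as the
-- product over the atoms a ≰ x of t = 1 + (t - 1) and expanding, Σ μ(x) t^(k - ρ(x)) = (t - 1)^k.
-- Finally the successive joins of the k atoms form a chain of length k, so k ≤ m.

module Submission where

module TamariLattice where

  open import Defs using (Bin; leaf; node; _⋖_; rot; inl; inr; _≤T_)
  open import Data.Nat
  open import Data.Nat.Properties
  open import Data.Nat.Tactic.RingSolver using (solve-∀)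
  open import Data.Product using (Σ; _×_; _,_)
  open import Data.Sum using (_⊎_; inj₁; inj₂)
  open import Data.Empty using (⊥-elim)
  open import Relation.Nullary using (¬_; yes; no)
  open import Relation.Binary.PropositionalEquality
  open import Relation.Binary.Definitions using (tri<; tri≈; tri>)
  open import Relation.Binary.Construct.Closure.ReflexiveTransitive using (ε; _◅_; _◅◅_)

  size : Bin → ℕ
  size leaf       = 0
  size (node a b) = suc (size a + size b)

  data Split (q : ℕ) : ℕ → Set where
    left  : ∀ {j} → j < q → Split q j
    root  : Split q q
    right : ∀ k → Split q (suc (q + k))

  split : ∀ q j → Split q j
  split q j with compare j q
  ... | less .j k    = left (s≤s (m≤m+n j k))
  ... | equal .j     = root
  ... | greater .q k = right k

  -- Internal nodes are numbered in in-order; bracket t j is the number of the first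
  -- internal node in the subtree of t rooted at node j (Huang and Tamari's bracketing).
  bracket : Bin → ℕ → ℕ
  bracket leaf       j = 0
  bracket (node a b) j with split (size a) j
  ... | left _  = bracket a j
  ... | root    = 0
  ... | right k = suc (size a + bracket b k)

  bracket-left : ∀ a b {j} → j < size a → bracket (node a b) j ≡ bracket a j
  bracket-left a b {j} j<a with split (size a) j
  ... | left _  = refl
  ... | root    = ⊥-elim (<-irrefl refl j<a)
  ... | right k = ⊥-elim (<-asym j<a (s≤s (m≤m+n (size a) k)))

  bracket-root : ∀ a b {j} → j ≡ size a → bracket (node a b) j ≡ 0
  bracket-root a b {j} j≡a with split (size a) j
  ... | left j<a = ⊥-elim (<-irrefl j≡a j<a)
  ... | root     = refl
  ... | right k  = ⊥-elim (<-irrefl (sym j≡a) (s≤s (m≤m+n (size a) k)))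

  bracket-right : ∀ a b {j} k → j ≡ suc (size a + k) → bracket (node a b) j ≡ suc (size a + bracket b k)
  bracket-right a b {j} k j≡ with split (size a) j
  ... | left j<a  = ⊥-elim (<-asym j<a (subst (size a <_) (sym j≡) (s≤s (m≤m+n (size a) k))))
  ... | root      = ⊥-elim (<-irrefl j≡ (s≤s (m≤m+n (size a) k)))
  ... | right k′  = cong (λ l → suc (size a + bracket b l)) (+-cancelˡ-≡ (size a) k′ k (suc-injective j≡))

  size-⋖ : ∀ {t t′} → t ⋖ t′ → size t ≡ size t′
  size-⋖ (rot a b c) = cong suc (reassoc (size a) (size b) (size c))
    where
    reassoc : ∀ x y z → suc (x + y) + z ≡ x + suc (y + z)
    reassoc = solve-∀
  size-⋖ (inl t p)   = cong (λ l → suc (l + size t)) (size-⋖ p)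
  size-⋖ (inr s p)   = cong (λ r → suc (size s + r)) (size-⋖ p)

  size-≤T : ∀ {t t′} → t ≤T t′ → size t ≡ size t′
  size-≤T ε        = refl
  size-≤T (p ◅ ps) = trans (size-⋖ p) (size-≤T ps)

  weight : Bin → ℕ
  weight leaf       = 0
  weight (node a b) = weight a + weight b + size b

  weight-⋖ : ∀ {t t′} → t ⋖ t′ → weight t < weight t′
  weight-⋖ (rot a b c) = subst (suc (weight a + weight b + size b + weight c + size c) ≤_)
    (sym (rearrange (weight a) (weight b) (weight c) (size b) (size c))) (s≤s (m≤m+n _ (size c)))
    where
    rearrange : ∀ wa wb wc b c → wa + (wb + wc + c) + suc (b + c) ≡ suc (wa + wb + b + wc + c + c)
    rearrange = solve-∀
  weight-⋖ (inl t p)   = +-monoˡ-< (size t) (+-monoˡ-< _ (weight-⋖ p))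
  weight-⋖ (inr s {t} p) rewrite sym (size-⋖ p) = +-monoˡ-< (size t) (+-monoʳ-< (weight s) (weight-⋖ p))

  weight-≤T : ∀ {t t′} → t ≤T t′ → weight t ≤ weight t′
  weight-≤T ε        = ≤-refl
  weight-≤T (p ◅ ps) = ≤-trans (<⇒≤ (weight-⋖ p)) (weight-≤T ps)

  weight-<T : ∀ {t t′} → t ≤T t′ → t ≢ t′ → weight t < weight t′
  weight-<T ε        t≢t = ⊥-elim (t≢t refl)
  weight-<T (p ◅ ps) _   = <-≤-trans (weight-⋖ p) (weight-≤T ps)

  weight≤size² : ∀ t → weight t ≤ size t * size t
  weight≤size² leaf       = z≤n
  weight≤size² (node a b) = ≤-trans (+-monoˡ-≤ (size b) (+-mono-≤ (weight≤size² a) (weight≤size² b)))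
    (subst (size a * size a + size b * size b + size b ≤_) (sym (expand (size a) (size b))) (m≤m+n _ _))
    where
    expand : ∀ x y → suc (x + y) * suc (x + y) ≡ x * x + y * y + y + (1 + x + x + y + x * y + x * y)
    expand = solve-∀

  ≤T-antisym : ∀ {t s} → t ≤T s → s ≤T t → t ≡ s
  ≤T-antisym ε        _  = refl
  ≤T-antisym (p ◅ ps) qs = ⊥-elim (<-irrefl refl (<-≤-trans (weight-⋖ p) (weight-≤T (ps ◅◅ qs))))

  module _ (a b c : Bin) where

    private
      rotated : ℕ
      rotated = suc (size a + size b)

    bracket-rot-before : bracket (node (node a b) c) rotated ≡ 0
    bracket-rot-before = bracket-root (node a b) c refl

    bracket-rot-after : bracket (node a (node b c)) rotated ≡ suc (size a)
    bracket-rot-after = begin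
      bracket (node a (node b c)) rotated        ≡⟨ bracket-right a (node b c) (size b) refl ⟩
      suc (size a + bracket (node b c) (size b)) ≡⟨ cong (λ x → suc (size a + x)) (bracket-root b c refl) ⟩
      suc (size a + 0)                           ≡⟨ cong suc (+-identityʳ (size a)) ⟩
      suc (size a)                               ∎
      where open ≡-Reasoning

    bracket-rot-other : ∀ j → j ≢ rotated → bracket (node a (node b c)) j ≡ bracket (node (node a b) c) j
    bracket-rot-other j j≢ with split (size a) j
    ... | left j<a = sym (trans (bracket-left (node a b) c (<-≤-trans j<a (m≤n⇒m≤1+n (m≤m+n _ _))))
                                (bracket-left a b j<a))
    ... | root     = sym (trans (bracket-left (node a b) c {size a} (s≤s (m≤m+n _ _))) (bracket-root a b refl))
    ... | right k with split (size b) k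
    ...   | left k<b  = sym (trans (bracket-left (node a b) c (s≤s (+-monoʳ-< (size a) k<b)))
                                   (bracket-right a b k refl))
    ...   | root      = ⊥-elim (j≢ refl)
    ...   | right k′  = sym (trans (bracket-right (node a b) c k′ (cong suc (reassoc (size a) (size b) k′)))
                                   (cong suc (reassoc′ (size a) (size b) (bracket c k′))))
      where
      reassoc : ∀ x y z → x + suc (y + z) ≡ suc (x + y) + z
      reassoc = solve-∀
      reassoc′ : ∀ x y z → suc (x + y) + z ≡ x + suc (y + z)
      reassoc′ = solve-∀

  bracket-node-mono : ∀ {a a′ b b′} → size a ≡ size a′ →
    (∀ j → bracket a j ≤ bracket a′ j) → (∀ j → bracket b j ≤ bracket b′ j) →
    ∀ j → bracket (node a b) j ≤ bracket (node a′ b′) j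
  bracket-node-mono {a} {a′} {b} {b′} a≡a′ a≤a′ b≤b′ j with split (size a) j
  ... | left j<a = ≤-trans (a≤a′ j) (≤-reflexive (sym (bracket-left a′ b′ (subst (j <_) a≡a′ j<a))))
  ... | root     = z≤n
  ... | right k  = ≤-trans (s≤s (+-mono-≤ (≤-reflexive a≡a′) (b≤b′ k)))
                           (≤-reflexive (sym (bracket-right a′ b′ k (cong (λ q → suc (q + k)) a≡a′))))

  bracket-mono-⋖ : ∀ {t t′} → t ⋖ t′ → ∀ j → bracket t j ≤ bracket t′ j
  bracket-mono-⋖ (rot a b c) j with j ≟ suc (size a + size b)
  ... | yes refl = subst (_≤ bracket (node a (node b c)) j) (sym (bracket-rot-before a b c)) z≤n
  ... | no j≢    = ≤-reflexive (sym (bracket-rot-other a b c j j≢))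
  bracket-mono-⋖ (inl t p)   = bracket-node-mono (size-⋖ p) (bracket-mono-⋖ p) (λ _ → ≤-refl)
  bracket-mono-⋖ (inr s p)   = bracket-node-mono refl (λ _ → ≤-refl) (bracket-mono-⋖ p)

  bracket-mono : ∀ {t t′} → t ≤T t′ → ∀ j → bracket t j ≤ bracket t′ j
  bracket-mono ε        j = ≤-refl
  bracket-mono (p ◅ ps) j = ≤-trans (bracket-mono-⋖ p j) (bracket-mono ps j)

  ⋖-changes-one-coordinate : ∀ {t t′} → t ⋖ t′ → Σ ℕ λ e → ∀ j → j ≢ e → bracket t′ j ≡ bracket t j
  ⋖-changes-one-coordinate (rot a b c) = suc (size a + size b) , bracket-rot-other a b c
  ⋖-changes-one-coordinate (inl {s} {s′} t p) with ⋖-changes-one-coordinate p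
  ... | e , same = e , unchanged
    where
    unchanged : ∀ j → j ≢ e → bracket (node s′ t) j ≡ bracket (node s t) j
    unchanged j j≢e with split (size s) j
    ... | left j<s = trans (bracket-left s′ t (subst (j <_) (size-⋖ p) j<s)) (same j j≢e)
    ... | root     = bracket-root s′ t (size-⋖ p)
    ... | right k  = trans (bracket-right s′ t k (cong (λ q → suc (q + k)) (size-⋖ p)))
                           (cong (λ q → suc (q + bracket t k)) (sym (size-⋖ p)))
  ⋖-changes-one-coordinate (inr s {t} {t′} p) with ⋖-changes-one-coordinate p
  ... | e , same = suc (size s + e) , unchanged
    where
    unchanged : ∀ j → j ≢ suc (size s + e) → bracket (node s t′) j ≡ bracket (node s t) j
    unchanged j j≢ with split (size s) j
    ... | left _  = refl
    ... | root    = refl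
    ... | right k = cong (λ x → suc (size s + x)) (same k (λ k≡e → j≢ (cong (λ i → suc (size s + i)) k≡e)))

  ≤-⊔-elim : ∀ {m n o} → ¬ m ≤ n → m ≤ n ⊔ o → m ≤ o
  ≤-⊔-elim {m} {n} {o} m≰n m≤n⊔o with ⊔-sel n o
  ... | inj₁ n⊔o≡n = ⊥-elim (m≰n (subst (m ≤_) n⊔o≡n m≤n⊔o))
  ... | inj₂ n⊔o≡o = subst (m ≤_) n⊔o≡o m≤n⊔o

  _≤[_]_ : (ℕ → ℕ) → ℕ → (ℕ → ℕ) → Set
  f ≤[ n ] g = ∀ j → j < n → f j ≤ g j

  _≗[_]_ : (ℕ → ℕ) → ℕ → (ℕ → ℕ) → Set
  f ≗[ n ] g = ∀ j → j < n → f j ≡ g j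

  -- The ranges [w j, j] are nested, as the in-order ranges of subtrees are.
  record IsBracketVector (n : ℕ) (w : ℕ → ℕ) : Set where
    field
      ≤-index : ∀ j → j < n → w j ≤ j
      nested  : ∀ i j → j < n → w j ≤ i → i ≤ j → w j ≤ w i

  open IsBracketVector

  private
    right-index< : ∀ {q k r} → suc (q + k) < suc (q + r) → k < r
    right-index< {q} lt = +-cancelˡ-< q _ _ (s≤s⁻¹ lt)

    right-index≤ : ∀ {q x y} → suc (q + x) ≤ suc (q + y) → x ≤ y
    right-index≤ {q} le = +-cancelˡ-≤ q _ _ (s≤s⁻¹ le)

    left-index< : ∀ {q j} r → j < q → j < suc (q + r)
    left-index< r j<q = <-≤-trans j<q (m≤n⇒m≤1+n (m≤m+n _ r))

  bracket-isBracketVector : ∀ t → IsBracketVector (size t) (bracket t)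
  bracket-isBracketVector leaf       = record { ≤-index = λ _ () ; nested = λ _ _ () }
  bracket-isBracketVector (node a b) = record { ≤-index = below-index ; nested = nests }
    where
    A = bracket-isBracketVector a
    B = bracket-isBracketVector b

    below-index : ∀ j → j < size (node a b) → bracket (node a b) j ≤ j
    below-index j j<n with split (size a) j
    ... | left j<a = ≤-index A j j<a
    ... | root     = z≤n
    ... | right k  = s≤s (+-monoʳ-≤ (size a) (≤-index B k (right-index< j<n)))

    nests : ∀ i j → j < size (node a b) → bracket (node a b) j ≤ i → i ≤ j →
            bracket (node a b) j ≤ bracket (node a b) i
    nests i j j<n with split (size a) j
    ... | left j<a = λ h i≤j → subst (bracket a j ≤_) (sym (bracket-left a b (≤-<-trans i≤j j<a)))
                                     (nested A i j j<a h i≤j)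
    ... | root     = λ _ _ → z≤n
    ... | right k with split (size a) i
    ...   | left i<a = λ h _ → ⊥-elim (<-asym i<a (<-≤-trans (s≤s (m≤m+n (size a) _)) h))
    ...   | root     = λ h _ → ⊥-elim (<-irrefl refl (<-≤-trans (s≤s (m≤m+n (size a) _)) h))
    ...   | right k′ = λ h i≤j → s≤s (+-monoʳ-≤ (size a)
                         (nested B k′ k (right-index< j<n) (right-index≤ h) (right-index≤ i≤j)))

  ⊔-isBracketVector : ∀ {n f g} → IsBracketVector n f → IsBracketVector n g →
                      IsBracketVector n (λ j → f j ⊔ g j)
  ⊔-isBracketVector F G = record
    { ≤-index = λ j j<n → ⊔-lub (≤-index F j j<n) (≤-index G j j<n)
    ; nested  = λ i j j<n h i≤j →
        ⊔-mono-≤ (nested F i j j<n (≤-trans (m≤m⊔n _ _) h) i≤j) (nested G i j j<n (≤-trans (m≤n⊔m _ _) h) i≤j)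
    }

  IsBracketVector-restrict : ∀ {m n w} → m ≤ n → IsBracketVector n w → IsBracketVector m w
  IsBracketVector-restrict m≤n W = record
    { ≤-index = λ j j<m → ≤-index W j (<-≤-trans j<m m≤n)
    ; nested  = λ i j j<m → nested W i j (<-≤-trans j<m m≤n)
    }

  Step : Bin → (ℕ → ℕ) → Set
  Step t w = bracket t ≗[ size t ] w ⊎ Σ Bin λ t′ → t ⋖ t′ × bracket t′ ≤[ size t ] w

  module _ (a b : Bin) {w : ℕ → ℕ} (below : bracket (node a b) ≤[ size (node a b) ] w) where

    private
      q = size a
      r = size b

    left-below : bracket a ≤[ q ] w
    left-below j j<q = subst (_≤ w j) (bracket-left a b j<q) (below j (left-index< r j<q))

    step-left : ∀ {a′} → a ⋖ a′ → bracket a′ ≤[ q ] w → bracket (node a′ b) ≤[ size (node a b) ] w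
    step-left {a′} a⋖a′ a′-below j j<n with split q j
    ... | left j<q = subst (_≤ w j) (sym (bracket-left a′ b (subst (j <_) (size-⋖ a⋖a′) j<q)))
                           (a′-below j j<q)
    ... | root     = subst (_≤ w q) (sym (bracket-root a′ b (size-⋖ a⋖a′))) z≤n
    ... | right k  = subst (_≤ w j) (sym (trans (bracket-right a′ b k (cong (λ s → suc (s + k)) (size-⋖ a⋖a′)))
                       (cong (λ s → suc (s + bracket b k)) (sym (size-⋖ a⋖a′)))))
                       (subst (_≤ w j) (bracket-right a b k refl) (below j j<n))

    right-part : ℕ → ℕ
    right-part k = w (suc (q + k)) ∸ suc q

    right-lower : ∀ k → k < r → suc q ≤ w (suc (q + k))
    right-lower k k<r = ≤-trans (s≤s (m≤m+n q _))
      (subst (_≤ w (suc (q + k))) (bracket-right a b k refl) (below (suc (q + k)) (s≤s (+-monoʳ-< q k<r))))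

    right-below : bracket b ≤[ r ] right-part
    right-below k k<r = m+n≤o⇒m≤o∸n (bracket b k)
      (subst (_≤ w (suc (q + k))) (trans (bracket-right a b k refl) (+-comm (suc q) _))
             (below (suc (q + k)) (s≤s (+-monoʳ-< q k<r))))

    right-valid : IsBracketVector (size (node a b)) w → IsBracketVector r right-part
    right-valid W = record
      { ≤-index = λ k k<r → m≤n+o⇒m∸n≤o _ (suc q) (≤-index W _ (s≤s (+-monoʳ-< q k<r)))
      ; nested  = λ i k k<r h i≤k → ∸-monoˡ-≤ (suc q) (nested W (suc (q + i)) (suc (q + k)) (s≤s (+-monoʳ-< q k<r))
                    (subst (_≤ suc q + i) (m+[n∸m]≡n (right-lower k k<r)) (+-monoʳ-≤ (suc q) h))
                    (s≤s (+-monoʳ-≤ q i≤k)))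
      }

    step-right : ∀ {b′} → bracket b′ ≤[ r ] right-part → bracket (node a b′) ≤[ size (node a b) ] w
    step-right {b′} b′-below j j<n with split q j
    ... | left j<q = left-below j j<q
    ... | root     = z≤n
    ... | right k  = subst (suc q + bracket b′ k ≤_) (m+[n∸m]≡n (right-lower k (right-index< j<n)))
                       (+-monoʳ-≤ (suc q) (b′-below k (right-index< j<n)))

    step-done : w q ≡ 0 → bracket a ≗[ q ] w → bracket b ≗[ r ] right-part →
                bracket (node a b) ≗[ size (node a b) ] w
    step-done wq≡0 a≗w b≗w j j<n with split q j
    ... | left j<q = a≗w j j<q
    ... | root     = sym wq≡0
    ... | right k  = trans (cong (suc q +_) (b≗w k (right-index< j<n)))
                           (m+[n∸m]≡n (right-lower k (right-index< j<n)))

  step-root : ∀ a b {w} → IsBracketVector (size (node a b)) w → bracket (node a b) ≤[ size (node a b) ] w →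
              bracket a ≗[ size a ] w → w (size a) ≢ 0 →
              Σ Bin λ t′ → node a b ⋖ t′ × bracket t′ ≤[ size (node a b) ] w
  step-root leaf         b     W _     _   w0≢0 = ⊥-elim (w0≢0 (n≤0⇒n≡0 (≤-index W 0 z<s)))
  step-root (node a₁ a₂) b {w} W below a≗w wq≢0 = node a₁ (node a₂ b) , rot a₁ a₂ b , rotated-below
    where
    rotated-below : bracket (node a₁ (node a₂ b)) ≤[ size (node (node a₁ a₂) b) ] w
    rotated-below j j<n with j ≟ suc (size a₁ + size a₂)
    ... | no j≢    = subst (_≤ w j) (sym (bracket-rot-other a₁ a₂ b j j≢)) (below j j<n)
    ... | yes refl = subst (_≤ w j) (sym (bracket-rot-after a₁ a₂ b)) (≰⇒> w≰a₁)
      where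
      -- by nestedness, w j ≤ size a₁ would give w j ≤ w (size a₁) = bracket (node a₁ a₂) (size a₁) = 0
      w≰a₁ : ¬ w j ≤ size a₁
      w≰a₁ h = wq≢0 (n≤0⇒n≡0 (≤-trans (nested W (size a₁) j j<n h (m≤n⇒m≤1+n (m≤m+n _ _)))
                 (≤-reflexive (trans (sym (a≗w (size a₁) (s≤s (m≤m+n _ _)))) (bracket-root a₁ a₂ refl)))))

  step : ∀ t {w} → IsBracketVector (size t) w → bracket t ≤[ size t ] w → Step t w
  step leaf       _ _ = inj₁ (λ _ ())
  step (node a b) {w} W below
    with step a (IsBracketVector-restrict (m≤n⇒m≤1+n (m≤m+n _ _)) W) (left-below a b below)
  ... | inj₂ (a′ , a⋖a′ , a′-below) = inj₂ (node a′ b , inl b a⋖a′ , step-left a b below a⋖a′ a′-below)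
  ... | inj₁ a≗w with w (size a) ≟ 0
  ...   | no wq≢0   = inj₂ (step-root a b W below a≗w wq≢0)
  ...   | yes wq≡0 with step b (right-valid a b below W) (right-below a b below)
  ...     | inj₁ b≗w                    = inj₁ (step-done a b below wq≡0 a≗w b≗w)
  ...     | inj₂ (b′ , b⋖b′ , b′-below) = inj₂ (node a b′ , inr a b⋖b′ , step-right a b below b′-below)

  -- Each step raises the weight, which is bounded by n², so n² steps suffice.
  climb : ∀ fuel {n} t {w} → size t ≡ n → n * n ≤ weight t + fuel →
          IsBracketVector n w → bracket t ≤[ n ] w → Σ Bin λ z → t ≤T z × bracket z ≗[ n ] w
  climb fuel t refl bound W below with step t W below
  ... | inj₁ t≗w = t , ε , t≗w
  climb zero t refl bound W below | inj₂ (t′ , t⋖t′ , _) =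
    ⊥-elim (<-irrefl refl (<-≤-trans (weight-⋖ t⋖t′)
      (≤-trans (subst (λ n → weight t′ ≤ n * n) (sym (size-⋖ t⋖t′)) (weight≤size² t′))
               (≤-trans bound (≤-reflexive (+-identityʳ (weight t)))))))
  climb (suc fuel) t refl bound W below | inj₂ (t′ , t⋖t′ , below′)
    with climb fuel t′ (sym (size-⋖ t⋖t′))
           (≤-trans bound (≤-trans (≤-reflexive (+-suc (weight t) fuel)) (+-monoˡ-≤ fuel (weight-⋖ t⋖t′)))) W below′
  ... | z , t′≤z , z≗w = z , t⋖t′ ◅ t′≤z , z≗w

  reach : ∀ t {w} → IsBracketVector (size t) w → bracket t ≤[ size t ] w →
          Σ Bin λ z → t ≤T z × bracket z ≗[ size t ] w
  reach t = climb (size t * size t) t refl (m≤n+m _ _)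

  bracket-after-root≢0 : ∀ a b j → size a < j → bracket (node a b) j ≢ 0
  bracket-after-root≢0 a b j a<j with split (size a) j
  ... | left j<a = λ _ → <-asym j<a a<j
  ... | root     = λ _ → <-irrefl refl a<j
  ... | right k  = λ ()

  bracket-injective : ∀ {n} t s → size t ≡ n → size s ≡ n → bracket t ≗[ n ] bracket s → t ≡ s
  bracket-injective leaf       leaf       _    _    _   = refl
  bracket-injective leaf       (node _ _) refl ()   _
  bracket-injective (node _ _) leaf       refl ()   _
  bracket-injective (node a b) (node c d) refl s≡t t≗s =
    cong₂ node (bracket-injective a c refl (sym a≡c) left≗) (bracket-injective b d refl (sym b≡d) right≗)
    where
    c<n : size c < size (node a b)
    c<n = subst (size c <_) s≡t (s≤s (m≤m+n _ _))

    a≡c : size a ≡ size c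
    a≡c with <-cmp (size a) (size c)
    ... | tri≈ _ a≡c _ = a≡c
    ... | tri< a<c _ _ = ⊥-elim (bracket-after-root≢0 a b (size c) a<c
                           (trans (t≗s (size c) c<n) (bracket-root c d refl)))
    ... | tri> _ _ c<a = ⊥-elim (bracket-after-root≢0 c d (size a) c<a
                           (trans (sym (t≗s (size a) (s≤s (m≤m+n _ _)))) (bracket-root a b refl)))

    b≡d : size b ≡ size d
    b≡d = +-cancelˡ-≡ (size a) _ _ (suc-injective (trans (sym s≡t) (cong (λ x → suc (x + size d)) (sym a≡c))))

    left≗ : bracket a ≗[ size a ] bracket c
    left≗ j j<a = trans (sym (bracket-left a b j<a))
                        (trans (t≗s j (left-index< (size b) j<a)) (bracket-left c d (subst (j <_) a≡c j<a)))

    right≗ : bracket b ≗[ size b ] bracket d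
    right≗ k k<b = +-cancelˡ-≡ (size a) _ _ (suc-injective
      (trans (sym (bracket-right a b k refl))
             (trans (t≗s _ (s≤s (+-monoʳ-< (size a) k<b))) (trans (bracket-right c d k (cong (λ x → suc (x + k)) a≡c))
                    (cong (λ x → suc (x + bracket d k)) (sym a≡c))))))

  bracket-reflects-≤ : ∀ t s → size t ≡ size s → bracket t ≤[ size t ] bracket s → t ≤T s
  bracket-reflects-≤ t s t≡s t≤s
    with reach t (subst (λ n → IsBracketVector n (bracket s)) (sym t≡s) (bracket-isBracketVector s)) t≤s
  ... | z , t≤z , z≗s = subst (t ≤T_) (bracket-injective z s (sym (size-≤T t≤z)) (sym t≡s) z≗s) t≤z

  record Join (x y : Bin) : Set where
    field
      join         : Bin
      left≤join    : x ≤T join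
      right≤join   : y ≤T join
      bracket-join : bracket join ≗[ size x ] (λ j → bracket x j ⊔ bracket y j)

  tamari-join : ∀ x y → size x ≡ size y → Join x y
  tamari-join x y x≡y with reach x (⊔-isBracketVector (bracket-isBracketVector x) y-valid) (λ j _ → m≤m⊔n _ _)
    where
    y-valid : IsBracketVector (size x) (bracket y)
    y-valid = subst (λ n → IsBracketVector n (bracket y)) (sym x≡y) (bracket-isBracketVector y)
  ... | z , x≤z , z≗x⊔y = record
    { join         = z
    ; left≤join    = x≤z
    ; right≤join   = bracket-reflects-≤ y z (trans (sym x≡y) (size-≤T x≤z))
                       (λ j j<y → subst (bracket y j ≤_) (sym (z≗x⊔y j (subst (j <_) (sym x≡y) j<y))) (m≤n⊔m _ _))
    ; bracket-join = z≗x⊔y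
    }

  module _ {x y} (J : Join x y) where
    open Join J

    join-least : ∀ {v} → x ≤T v → y ≤T v → join ≤T v
    join-least {v} x≤v y≤v = bracket-reflects-≤ join v (trans (sym (size-≤T left≤join)) (size-≤T x≤v))
      λ j j<n → subst (_≤ bracket v j) (sym (bracket-join j (subst (j <_) (sym (size-≤T left≤join)) j<n)))
                  (⊔-lub (bracket-mono x≤v j) (bracket-mono y≤v j))

    -- A cover of u differs from u in one coordinate only, where max takes one of its arguments.
    cover-below-join : ∀ {u a} → u ⋖ a → u ≤T x → u ≤T y → a ≤T join → a ≤T x ⊎ a ≤T y
    cover-below-join {u} {a} u⋖a u≤x u≤y a≤join with ⋖-changes-one-coordinate u⋖a
    ... | e , same with bracket a e ≤? bracket x e
    ...   | yes ae≤xe = inj₁ (bracket-reflects-≤ a x a≡x below-x)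
      where
      a≡x : size a ≡ size x
      a≡x = trans (sym (size-⋖ u⋖a)) (size-≤T u≤x)
      below-x : bracket a ≤[ size a ] bracket x
      below-x j _ with j ≟ e
      ... | yes refl = ae≤xe
      ... | no j≢e   = subst (_≤ bracket x j) (sym (same j j≢e)) (bracket-mono u≤x j)
    ...   | no ae≰xe = inj₂ (bracket-reflects-≤ a y a≡y below-y)
      where
      a≡y : size a ≡ size y
      a≡y = trans (sym (size-⋖ u⋖a)) (size-≤T u≤y)
      below-y : bracket a ≤[ size a ] bracket y
      below-y j j<a with j ≟ e
      ... | yes refl = ≤-⊔-elim ae≰xe
        (subst (bracket a j ≤_) (bracket-join j (subst (j <_) (sym x≡a) j<a)) (bracket-mono a≤join j))
        where
        x≡a : size x ≡ size a
        x≡a = trans (sym (size-≤T u≤x)) (size-⋖ u⋖a)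
      ... | no j≢e   = subst (_≤ bracket y j) (sym (same j j≢e)) (bracket-mono u≤y j)

module Intervals where

  open import Defs
  open import Data.Nat using (zero; suc; _≤_; _<_; s≤s⁻¹)
  open import Data.Nat.Properties using (≤-refl; <-irrefl; <-≤-trans)
  open import Data.Product using (Σ; _×_; _,_; proj₁; proj₂)
  open import Data.Sum using (_⊎_)
  import Data.Sum as Sum
  open import Data.Empty using (⊥-elim)
  open import Data.List using (List; []; _∷_; length)
  open import Data.List.Relation.Unary.All as All using (All; []; _∷_)
  open import Data.List.Relation.Unary.AllPairs using ([]; _∷_)
  open import Data.List.Relation.Unary.Linked using ([-]; _∷_)
  open import Data.List.Relation.Unary.Unique.Propositional using (Unique)
  open import Data.List.Relation.Unary.Any using (any?)
  open import Data.List.Membership.Propositional using (_∈_; lose; find)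
  open import Relation.Nullary using (¬_; yes; no)
  open import Relation.Nullary.Decidable using (_×-dec_; ¬?)
  open import Relation.Binary using (Decidable)
  open import Relation.Binary.Definitions using (DecidableEquality)
  open import Relation.Binary.PropositionalEquality
  open import Relation.Binary.Construct.Closure.ReflexiveTransitive using (ε; _◅_; _◅◅_)
  open import Function.Bundles using (Equivalence)
  open TamariLattice
  open Equivalence using (to; from)

  _≟_ : DecidableEquality Bin
  leaf     ≟ leaf     = yes refl
  leaf     ≟ node _ _ = no λ ()
  node _ _ ≟ leaf     = no λ ()
  node a b ≟ node c d with a ≟ c | b ≟ d
  ... | yes refl | yes refl = yes refl
  ... | no a≢c   | _        = no λ { refl → a≢c refl }
  ... | yes _    | no b≢d   = no λ { refl → b≢d refl }

  module _ {u v : Bin} where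

    atom⇒cover : ∀ {a} → IsAtom u v a → u ⋖ a
    atom⇒cover {a} ((u≤a , _) , (_ , u≢a) , nothing-between) = first-step u≤a u≢a
      where
      first-step : u ≤T a → u ≢ a → u ⋖ a
      first-step ε                    u≢u = ⊥-elim (u≢u refl)
      first-step (_◅_ {j = w} u⋖w w≤a) _ with w ≟ a
      ... | yes refl = u⋖w
      ... | no w≢a   = ⊥-elim (nothing-between w (u⋖w ◅ ε , λ u≡w → <-irrefl (cong weight u≡w) (weight-⋖ u⋖w))
                                                  (w≤a , w≢a))

    atom-≰-bottom : ∀ {a} → IsAtom u v a → ¬ a ≤T u
    atom-≰-bottom ((u≤a , _) , (_ , u≢a) , _) a≤u = u≢a (≤T-antisym u≤a a≤u)

    atom-≤-atom : ∀ {a b} → IsAtom u v a → IsAtom u v b → a ≤T b → a ≡ b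
    atom-≤-atom {a} {b} a-atom (_ , _ , nothing-below-b) a≤b with a ≟ b
    ... | yes a≡b = a≡b
    ... | no a≢b  = ⊥-elim (nothing-below-b a (proj₁ (proj₂ a-atom)) (a≤b , a≢b))

    record IntervalJoin (x y : Bin) : Set where
      field
        join       : Bin
        join∈I     : InI u v join
        left≤join  : x ≤T join
        right≤join : y ≤T join
        atom≤join⇒ : ∀ a → IsAtom u v a → a ≤T join → a ≤T x ⊎ a ≤T y

    interval-join : ∀ {x y} → InI u v x → InI u v y → IntervalJoin x y
    interval-join {x} {y} (u≤x , x≤v) (u≤y , y≤v) = record
      { join       = join
      ; join∈I     = u≤x ◅◅ left≤join , join-least x∨y x≤v y≤v
      ; left≤join  = left≤join
      ; right≤join = right≤join
      ; atom≤join⇒ = λ a a-atom → cover-below-join x∨y (atom⇒cover a-atom) u≤x u≤y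
      }
      where
      x∨y = tamari-join x y (trans (sym (size-≤T u≤x)) (size-≤T u≤y))
      open Join x∨y

    -- Join the atoms in one by one: no atom lies below the join of the others, so each join is a strict step.
    chain-of-atoms : ∀ B {z} → InI u v z → Unique B → All (IsAtom u v) B → All (λ b → ¬ b ≤T z) B →
                     Σ (List Bin) λ c → IsChainIn u v (z ∷ c) × length c ≡ length B
    chain-of-atoms []      z∈I _          _                  _           = [] , (z∈I ∷ [] , [-]) , refl
    chain-of-atoms (b ∷ B) {z} z∈I (b∉B ∷ B!) (b-atom ∷ B-atoms) (b≰z ∷ B≰z) =
      extend (chain-of-atoms B join∈I B! B-atoms B≰join)
      where
      open IntervalJoin (interval-join z∈I (proj₁ b-atom))

      B≰join : All (λ b′ → ¬ b′ ≤T join) B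
      B≰join = All.tabulate λ {b′} b′∈B b′≤join →
        Sum.[ All.lookup B≰z b′∈B
            , (λ b′≤b → All.lookup b∉B b′∈B (sym (atom-≤-atom (All.lookup B-atoms b′∈B) b-atom b′≤b))) ]
          (atom≤join⇒ b′ (All.lookup B-atoms b′∈B) b′≤join)

      z<join : z <T join
      z<join = left≤join , λ z≡join → b≰z (subst (b ≤T_) (sym z≡join) right≤join)

      extend : (Σ (List Bin) λ c → IsChainIn u v (join ∷ c) × length c ≡ length B) →
               Σ (List Bin) λ c → IsChainIn u v (z ∷ c) × length c ≡ length (b ∷ B)
      extend (c , (c∈I , c-chain) , length≡) = join ∷ c , (z∈I ∷ c∈I , z<join ∷ c-chain) , cong suc length≡

    atoms≤longest-chain : ∀ {A m} → u ≤T v → Enumerates (IsAtom u v) A → IsLongestChainLength u v m →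
                          length A ≤ m
    atoms≤longest-chain {A} u≤v (A! , A⇔atom) (_ , longest)
      with chain-of-atoms A (ε , u≤v) A! (All.tabulate (to (A⇔atom _)))
                          (All.tabulate (λ a∈A → atom-≰-bottom (to (A⇔atom _) a∈A)))
    ... | c , u∷c-chain , length≡ = s≤s⁻¹ (subst (λ k → suc k ≤ _) length≡ (longest (u ∷ c) u∷c-chain))

  module _ (dec : Decidable _≤T_) {u v : Bin} {L A : List Bin}
           (L-enum : Enumerates (InI u v) L) (A-enum : Enumerates (IsAtom u v) A) where

    -- Descend through strictly smaller elements above u until none is left; the weight bounds the descent.
    atom-below : ∀ {x} → InI u v x → u ≢ x → Σ Bin λ a → a ∈ A × a ≤T x
    atom-below {x} = descend (suc (weight x)) x ≤-refl
      where
      _<T?_ : Decidable _<T_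
      y <T? z = dec y z ×-dec ¬? (y ≟ z)

      descend : ∀ fuel x → weight x < fuel → InI u v x → u ≢ x → Σ Bin λ a → a ∈ A × a ≤T x
      descend zero       x ()
      descend (suc fuel) x w<fuel x∈I u≢x with any? (λ y → u <T? y ×-dec y <T? x) L
      ... | yes ∃y with find ∃y
      ...   | y , y∈L , ((u≤y , u≢y) , (y≤x , y≢x))
                with descend fuel y (<-≤-trans (weight-<T y≤x y≢x) (s≤s⁻¹ w<fuel))
                                    (to (proj₂ L-enum y) y∈L) u≢y
      ...     | a , a∈A , a≤y = a , a∈A , a≤y ◅◅ y≤x
      descend (suc fuel) x w<fuel x∈I u≢x | no ∄y = x , from (proj₂ A-enum x) x-atom , ε
        where
        x-atom : IsAtom u v x
        x-atom = x∈I , (proj₁ x∈I , u≢x) , λ y u<y y<x →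
          ∄y (lose (from (proj₂ L-enum y) (proj₁ u<y , proj₁ y<x ◅◅ proj₂ x∈I)) (u<y , y<x))

module AtomSums where

  open import Defs
  open import Data.Nat using (_∸_; _≤_) renaming (_+_ to _+ℕ_)
  import Data.Nat.Properties as ℕ
  open import Data.Integer using (ℤ; +_; _+_; _*_; _-_; _^_)
  import Data.Integer.Properties as ℤ
  open import Data.Integer.Tactic.RingSolver using (solve-∀)
  open import Data.Product using (_×_; _,_; proj₁; proj₂)
  open import Data.Sum using (_⊎_; inj₁; inj₂)
  import Data.Sum as Sum
  open import Data.Empty using (⊥-elim)
  open import Data.List using (List; []; _∷_; length; map)
  open import Data.List.Properties using (filter-accept; filter-reject; length-filter)
  open import Data.List.Relation.Unary.Any using (here; there)
  open import Data.List.Relation.Unary.All as All using (All; []; _∷_)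
  open import Data.List.Relation.Unary.AllPairs using ([]; _∷_)
  open import Data.List.Relation.Unary.Unique.Propositional using (Unique)
  open import Data.List.Membership.Propositional using (_∈_; _∉_)
  open import Relation.Nullary using (¬_; Dec; yes; no)
  open import Relation.Nullary.Decidable using (_⊎-dec_; _→-dec_)
  open import Relation.Binary using (Decidable)
  open import Relation.Binary.PropositionalEquality
  open import Relation.Binary.Construct.Closure.ReflexiveTransitive using (ε; _◅◅_)
  open import Function.Bundles using (Equivalence)
  open TamariLattice using (≤T-antisym)
  open Intervals
  open import Data.List.Membership.DecPropositional _≟_ using (_∈?_)
  open Equivalence using (to; from)

  indicator : ∀ {P : Set} → Dec P → ℤ
  indicator (yes _) = + 1
  indicator (no _)  = + 0

  indicator-⇔ : ∀ {P Q : Set} → (P → Q) → (Q → P) → (P? : Dec P) (Q? : Dec Q) → indicator P? ≡ indicator Q?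
  indicator-⇔ _ _ (yes _) (yes _) = refl
  indicator-⇔ f _ (yes p) (no ¬q) = ⊥-elim (¬q (f p))
  indicator-⇔ _ g (no ¬p) (yes q) = ⊥-elim (¬p (g q))
  indicator-⇔ _ _ (no _)  (no _)  = refl

  indicator-no : ∀ {P : Set} → ¬ P → (P? : Dec P) → indicator P? ≡ + 0
  indicator-no ¬p (yes p) = ⊥-elim (¬p p)
  indicator-no _  (no _)  = refl

  indicator-yes : ∀ {P : Set} → P → (P? : Dec P) → indicator P? ≡ + 1
  indicator-yes _ (yes _) = refl
  indicator-yes p (no ¬p) = ⊥-elim (¬p p)

  module _ {X : Set} where

    sumℤ-cong : ∀ (xs : List X) {f g : X → ℤ} → (∀ x → f x ≡ g x) → sumℤ (map f xs) ≡ sumℤ (map g xs)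
    sumℤ-cong []       _   = refl
    sumℤ-cong (x ∷ xs) f≗g = cong₂ _+_ (f≗g x) (sumℤ-cong xs f≗g)

    sumℤ-+-* : ∀ (xs : List X) (f g : X → ℤ) c →
               sumℤ (map (λ x → f x + c * g x) xs) ≡ sumℤ (map f xs) + c * sumℤ (map g xs)
    sumℤ-+-* []       f g c = sym (trans (ℤ.+-identityˡ _) (ℤ.*-zeroʳ c))
    sumℤ-+-* (x ∷ xs) f g c rewrite sumℤ-+-* xs f g c =
      rearrange (f x) (g x) (sumℤ (map f xs)) (sumℤ (map g xs)) c
      where
      rearrange : ∀ a b s₁ s₂ c → a + c * b + (s₁ + c * s₂) ≡ a + s₁ + c * (b + s₂)
      rearrange = solve-∀

    sumℤ-* : ∀ (xs : List X) (f : X → ℤ) c → sumℤ (map (λ x → c * f x) xs) ≡ c * sumℤ (map f xs)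
    sumℤ-* []       f c = sym (ℤ.*-zeroʳ c)
    sumℤ-* (x ∷ xs) f c = trans (cong (λ s → c * f x + s) (sumℤ-* xs f c)) (sym (ℤ.*-distribˡ-+ c (f x) _))

  module _ (dec : Decidable _≤T_) (μ : Bin → ℤ) where

    sum-indicator≡sum-below : ∀ (L′ : List Bin) {P : Bin → Set} (P? : ∀ x → Dec (P x)) j →
      (∀ {x} → x ∈ L′ → (P x → x ≤T j) × (x ≤T j → P x)) →
      sumℤ (map (λ x → indicator (P? x) * μ x) L′) ≡ sumℤ (map μ (below dec L′ j))
    sum-indicator≡sum-below [] _ _ _ = refl
    sum-indicator≡sum-below (x ∷ L′) P? j P⇔≤j with P? x
    ... | yes p rewrite filter-accept (λ y → dec y j) {x} {L′} (proj₁ (P⇔≤j (here refl)) p) =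
          cong₂ _+_ (ℤ.*-identityˡ (μ x)) (sum-indicator≡sum-below L′ P? j (λ p → P⇔≤j (there p)))
    ... | no ¬p rewrite filter-reject (λ y → dec y j) {x} {L′} (λ x≤j → ¬p (proj₂ (P⇔≤j (here refl)) x≤j)) =
          trans (ℤ.+-identityˡ _) (sum-indicator≡sum-below L′ P? j (λ p → P⇔≤j (there p)))

  module AtomExpansion (dec : Decidable _≤T_) {u v : Bin} (u≤v : u ≤T v) {L A : List Bin}
           (L-enum : Enumerates (InI u v) L) (A-enum : Enumerates (IsAtom u v) A)
           {μ : Bin → ℤ} (μ-mobius : IsMobius dec u v L μ) (t : ℤ) where

    private
      ∈L⇒∈I : ∀ {x} → x ∈ L → InI u v x
      ∈L⇒∈I {x} = to (proj₂ L-enum x)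
      ∈I⇒∈L : ∀ {x} → InI u v x → x ∈ L
      ∈I⇒∈L {x} = from (proj₂ L-enum x)
      ∈A⇒atom : ∀ {a} → a ∈ A → IsAtom u v a
      ∈A⇒atom {a} = to (proj₂ A-enum a)

    AtomsBelowIn : (Bin → Set) → Bin → Set
    AtomsBelowIn S x = All (λ a → a ≤T x → S a) A

    atomsBelowIn? : ∀ {S} → (∀ a → Dec (S a)) → ∀ x → Dec (AtomsBelowIn S x)
    atomsBelowIn? S? x = All.all? (λ a → dec a x →-dec S? a) A

    atomsBelowIn-map : ∀ {S S′ x} → (∀ {a} → a ≤T x → S a → S′ a) → AtomsBelowIn S x → AtomsBelowIn S′ x
    atomsBelowIn-map f = All.map (λ h a≤x → f a≤x (h a≤x))

    atomsBelowIn-↓ : ∀ {S x y} → y ≤T x → AtomsBelowIn S x → AtomsBelowIn S y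
    atomsBelowIn-↓ y≤x = All.map (λ h a≤y → h (a≤y ◅◅ y≤x))

    atomsBelowIn-bottom : ∀ {S} → AtomsBelowIn S u
    atomsBelowIn-bottom = All.tabulate (λ a∈A a≤u → ⊥-elim (atom-≰-bottom (∈A⇒atom a∈A) a≤u))

    atomsBelowIn-join : ∀ {S x y} → AtomsBelowIn S x → AtomsBelowIn S y →
                        (J : IntervalJoin x y) → AtomsBelowIn S (IntervalJoin.join J)
    atomsBelowIn-join Sx Sy J = All.tabulate λ a∈A a≤join →
      Sum.[ All.lookup Sx a∈A , All.lookup Sy a∈A ] (IntervalJoin.atom≤join⇒ J _ (∈A⇒atom a∈A) a≤join)

    record Greatest (S : Bin → Set) (L′ : List Bin) (z : Bin) : Set where
      field
        top       : Bin
        top∈I     : InI u v top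
        top-atoms : AtomsBelowIn S top
        z≤top     : z ≤T top
        ≤top      : ∀ {x} → x ∈ L′ → AtomsBelowIn S x → x ≤T top

    greatest : ∀ {S} → (∀ a → Dec (S a)) → ∀ L′ → (∀ {x} → x ∈ L′ → InI u v x) →
               ∀ {z} → InI u v z → AtomsBelowIn S z → Greatest S L′ z
    greatest S? []       _     {z} z∈I Sz = record
      { top = z ; top∈I = z∈I ; top-atoms = Sz ; z≤top = ε ; ≤top = λ () }
    greatest S? (x ∷ L′) L′⊆I {z} z∈I Sz with atomsBelowIn? S? x
    ... | yes Sx = record
      { top = top ; top∈I = top∈I ; top-atoms = top-atoms
      ; z≤top = IntervalJoin.left≤join z∨x ◅◅ z≤top
      ; ≤top  = λ { (here refl) _ → IntervalJoin.right≤join z∨x ◅◅ z≤top ; (there y∈L′) Sy → ≤top y∈L′ Sy }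
      }
      where
      z∨x = interval-join z∈I (L′⊆I (here refl))
      open Greatest (greatest S? L′ (λ y∈L′ → L′⊆I (there y∈L′)) (IntervalJoin.join∈I z∨x)
                              (atomsBelowIn-join Sz Sx z∨x))
    ... | no ¬Sx = record
      { top = top ; top∈I = top∈I ; top-atoms = top-atoms ; z≤top = z≤top
      ; ≤top  = λ { (here refl) Sx → ⊥-elim (¬Sx Sx) ; (there y∈L′) Sy → ≤top y∈L′ Sy }
      }
      where
      open Greatest (greatest S? L′ (λ y∈L′ → L′⊆I (there y∈L′)) z∈I Sz)

    _∪_ : List Bin → List Bin → Bin → Set
    (B ∪ E) a = a ∈ B ⊎ a ∈ E

    _∪?_ : ∀ B E a → Dec ((B ∪ E) a)
    (B ∪? E) a = (a ∈? B) ⊎-dec (a ∈? E)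

    oneOrT : ∀ {P : Set} → Dec P → ℤ
    oneOrT (yes _) = + 1
    oneOrT (no _)  = t

    missing : List Bin → Bin → ℤ
    missing []      x = + 1
    missing (a ∷ B) x = oneOrT (dec a x) * missing B x

    missing≡t^ : ∀ B x → missing B x ≡ t ^ (length B ∸ ρ dec B x)
    missing≡t^ []      x = refl
    missing≡t^ (a ∷ B) x with dec a x
    ... | yes _ = trans (ℤ.*-identityˡ _) (missing≡t^ B x)
    ... | no _  = trans (cong (t *_) (missing≡t^ B x))
                        (cong (t ^_) (sym (ℕ.+-∸-assoc 1 (length-filter (λ y → dec y x) B))))

    -- partialSum A [] = Σ μ(x) t^(k - ρ(x)) by missing≡t^, while partialSum [] E is the Möbius
    -- sum over [u, z], z the greatest element of I all of whose atoms lie in E.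
    term : List Bin → List Bin → Bin → ℤ
    term B E x = indicator (atomsBelowIn? (B ∪? E) x) * (μ x * missing B x)

    partialSum : List Bin → List Bin → ℤ
    partialSum B E = sumℤ (map (term B E) L)

    partialSum-[]≡sum-below : ∀ E j →
      (∀ {x} → x ∈ L → (AtomsBelowIn ([] ∪ E) x → x ≤T j) × (x ≤T j → AtomsBelowIn ([] ∪ E) x)) →
      partialSum [] E ≡ sumℤ (map μ (below dec L j))
    partialSum-[]≡sum-below E j ≤j⇔ =
      trans (sumℤ-cong L (λ x → cong (indicator (atomsBelowIn? ([] ∪? E) x) *_) (ℤ.*-identityʳ (μ x))))
            (sum-indicator≡sum-below dec μ L (atomsBelowIn? ([] ∪? E)) j ≤j⇔)

    -- Only u has no atom below it.
    partialSum-[]-[] : partialSum [] [] ≡ + 1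
    partialSum-[]-[] = trans (partialSum-[]≡sum-below [] u only-u) (proj₁ μ-mobius)
      where
      only-u : ∀ {x} → x ∈ L → (AtomsBelowIn ([] ∪ []) x → x ≤T u) × (x ≤T u → AtomsBelowIn ([] ∪ []) x)
      only-u {x} x∈L = no-atoms⇒≤u , λ x≤u →
        subst (AtomsBelowIn ([] ∪ [])) (≤T-antisym (proj₁ (∈L⇒∈I x∈L)) x≤u) atomsBelowIn-bottom
        where
        no-atoms⇒≤u : AtomsBelowIn ([] ∪ []) x → x ≤T u
        no-atoms⇒≤u none with x ≟ u
        ... | yes refl = ε
        ... | no x≢u with atom-below dec L-enum A-enum (∈L⇒∈I x∈L) (λ u≡x → x≢u (sym u≡x))
        ...   | a , a∈A , a≤x with All.lookup none a∈A a≤x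
        ...     | inj₁ ()
        ...     | inj₂ ()

    -- The elements all of whose atoms lie in e ∷ E have a greatest element, lying above the atom e.
    partialSum-[]-∷ : ∀ e E → e ∈ A → partialSum [] (e ∷ E) ≡ + 0
    partialSum-[]-∷ e E e∈A =
      trans (partialSum-[]≡sum-below (e ∷ E) top ≤top⇔) (proj₂ μ-mobius top top∈I top≢u)
      where
      open Greatest (greatest ([] ∪? (e ∷ E)) L ∈L⇒∈I (ε , u≤v) atomsBelowIn-bottom)
      e-atom = ∈A⇒atom e∈A
      ≤top⇔ : ∀ {x} → x ∈ L →
              (AtomsBelowIn ([] ∪ (e ∷ E)) x → x ≤T top) × (x ≤T top → AtomsBelowIn ([] ∪ (e ∷ E)) x)
      ≤top⇔ x∈L = ≤top x∈L , λ x≤top → atomsBelowIn-↓ x≤top top-atoms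
      only-e : AtomsBelowIn ([] ∪ (e ∷ E)) e
      only-e = All.tabulate λ a∈A a≤e → inj₂ (here (atom-≤-atom (∈A⇒atom a∈A) e-atom a≤e))
      top≢u : top ≢ u
      top≢u top≡u = atom-≰-bottom e-atom (subst (e ≤T_) top≡u (≤top (∈I⇒∈L (proj₁ e-atom)) only-e))

    private
      ∷∪⇒∪∷ : ∀ {a B E a′} → ((a ∷ B) ∪ E) a′ → (B ∪ (a ∷ E)) a′
      ∷∪⇒∪∷ (inj₁ (here a′≡a))  = inj₂ (here a′≡a)
      ∷∪⇒∪∷ (inj₁ (there a′∈B)) = inj₁ a′∈B
      ∷∪⇒∪∷ (inj₂ a′∈E)         = inj₂ (there a′∈E)

      ∪∷⇒∷∪ : ∀ {a B E a′} → (B ∪ (a ∷ E)) a′ → ((a ∷ B) ∪ E) a′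
      ∪∷⇒∷∪ (inj₁ a′∈B)         = inj₁ (there a′∈B)
      ∪∷⇒∷∪ (inj₂ (here a′≡a))  = inj₁ (here a′≡a)
      ∪∷⇒∷∪ (inj₂ (there a′∈E)) = inj₂ a′∈E

      ∷∪⇒∪ : ∀ {a B E a′} → a′ ≢ a → ((a ∷ B) ∪ E) a′ → (B ∪ E) a′
      ∷∪⇒∪ a′≢a (inj₁ (here a′≡a))  = ⊥-elim (a′≢a a′≡a)
      ∷∪⇒∪ _    (inj₁ (there a′∈B)) = inj₁ a′∈B
      ∷∪⇒∪ _    (inj₂ a′∈E)         = inj₂ a′∈E

      ∪∷⇒∪ : ∀ {a B E a′} → a′ ≢ a → (B ∪ (a ∷ E)) a′ → (B ∪ E) a′
      ∪∷⇒∪ _    (inj₁ a′∈B)         = inj₁ a′∈B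
      ∪∷⇒∪ a′≢a (inj₂ (here a′≡a))  = ⊥-elim (a′≢a a′≡a)
      ∪∷⇒∪ _    (inj₂ (there a′∈E)) = inj₂ a′∈E

      ≤-≰⇒≢ : ∀ {a′ a x} → a′ ≤T x → ¬ a ≤T x → a′ ≢ a
      ≤-≰⇒≢ a′≤x a≰x refl = a≰x a′≤x

    outside-atom⇒¬atomsBelowIn : ∀ {a B E x} → a ∈ A → All (a ≢_) B → a ∉ E → a ≤T x →
                                 ¬ AtomsBelowIn (B ∪ E) x
    outside-atom⇒¬atomsBelowIn a∈A a∉B a∉E a≤x allowed with All.lookup allowed a∈A a≤x
    ... | inj₁ a∈B = All.lookup a∉B a∈B refl
    ... | inj₂ a∈E = a∉E a∈E

    -- Write the factor of a as 1 + (t - 1)·[a ≰ x]: inclusion–exclusion over one atom.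
    term-∷ : ∀ {a B E} → a ∈ A → All (a ≢_) B → a ∉ E →
             ∀ x → term (a ∷ B) E x ≡ term B (a ∷ E) x + (t - + 1) * term B E x
    term-∷ {a} {B} {E} a∈A a∉B a∉E x with dec a x
    ... | yes a≤x
      rewrite indicator-⇔ (atomsBelowIn-map (λ _ → ∷∪⇒∪∷)) (atomsBelowIn-map (λ _ → ∪∷⇒∷∪))
                          (atomsBelowIn? ((a ∷ B) ∪? E) x) (atomsBelowIn? (B ∪? (a ∷ E)) x)
            | indicator-no (outside-atom⇒¬atomsBelowIn a∈A a∉B a∉E a≤x) (atomsBelowIn? (B ∪? E) x)
      = expand (indicator (atomsBelowIn? (B ∪? (a ∷ E)) x)) (μ x) (missing B x) t
      where
      expand : ∀ i m P t → i * (m * (+ 1 * P)) ≡ i * (m * P) + (t - + 1) * (+ 0 * (m * P))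
      expand = solve-∀
    ... | no a≰x
      rewrite indicator-⇔ (atomsBelowIn-map (λ a′≤x → ∷∪⇒∪ (≤-≰⇒≢ a′≤x a≰x)))
                          (atomsBelowIn-map (λ _ → Sum.map₁ there))
                          (atomsBelowIn? ((a ∷ B) ∪? E) x) (atomsBelowIn? (B ∪? E) x)
            | indicator-⇔ (atomsBelowIn-map (λ a′≤x → ∪∷⇒∪ (≤-≰⇒≢ a′≤x a≰x)))
                          (atomsBelowIn-map (λ _ → Sum.map₂ there))
                          (atomsBelowIn? (B ∪? (a ∷ E)) x) (atomsBelowIn? (B ∪? E) x)
      = expand (indicator (atomsBelowIn? (B ∪? E) x)) (μ x) (missing B x) t
      where
      expand : ∀ i m P t → i * (m * (t * P)) ≡ i * (m * P) + (t - + 1) * (i * (m * P))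
      expand = solve-∀

    expected : List Bin → List Bin → ℤ
    expected B []      = (t - + 1) ^ length B
    expected B (_ ∷ _) = + 0

    partialSum≡expected : ∀ B E → Unique B → (∀ {b} → b ∈ B → b ∉ E) → All (_∈ A) B → All (_∈ A) E →
                          partialSum B E ≡ expected B E
    partialSum≡expected []      []      _          _        _            _         = partialSum-[]-[]
    partialSum≡expected []      (e ∷ E) _          _        _            (e∈A ∷ _) = partialSum-[]-∷ e E e∈A
    partialSum≡expected (a ∷ B) E       (a∉B ∷ B!) disjoint (a∈A ∷ B⊆A) E⊆A = begin
      partialSum (a ∷ B) E
        ≡⟨ sumℤ-cong L (term-∷ a∈A a∉B (disjoint (here refl))) ⟩
      sumℤ (map (λ x → term B (a ∷ E) x + (t - + 1) * term B E x) L)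
        ≡⟨ sumℤ-+-* L (term B (a ∷ E)) (term B E) (t - + 1) ⟩
      partialSum B (a ∷ E) + (t - + 1) * partialSum B E
        ≡⟨ cong₂ (λ p q → p + (t - + 1) * q)
             (partialSum≡expected B (a ∷ E) B! disjoint-∷ B⊆A (a∈A ∷ E⊆A))
             (partialSum≡expected B E B! (λ b∈B → disjoint (there b∈B)) B⊆A E⊆A) ⟩
      + 0 + (t - + 1) * expected B E
        ≡⟨ collect E ⟩
      expected (a ∷ B) E ∎
      where
      open ≡-Reasoning
      disjoint-∷ : ∀ {b} → b ∈ B → b ∉ a ∷ E
      disjoint-∷ b∈B (here b≡a)  = All.lookup a∉B b∈B (sym b≡a)
      disjoint-∷ b∈B (there b∈E) = disjoint (there b∈B) b∈E
      collect : ∀ E → + 0 + (t - + 1) * expected B E ≡ expected (a ∷ B) E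
      collect []      = ℤ.+-identityˡ _
      collect (_ ∷ _) = trans (ℤ.+-identityˡ _) (ℤ.*-zeroʳ (t - + 1))

    term-A-[] : ∀ {m} → length A ≤ m →
                ∀ x → μ x * t ^ (m ∸ ρ dec A x) ≡ t ^ (m ∸ length A) * term A [] x
    term-A-[] {m} k≤m x = begin
      μ x * t ^ (m ∸ r)                             ≡⟨ cong (λ e → μ x * t ^ e) split-exponent ⟩
      μ x * t ^ ((m ∸ k) +ℕ (k ∸ r))                ≡⟨ cong (μ x *_) (ℤ.^-distribˡ-+-* t (m ∸ k) (k ∸ r)) ⟩
      μ x * (t ^ (m ∸ k) * t ^ (k ∸ r))             ≡⟨ rearrange (μ x) (t ^ (m ∸ k)) (t ^ (k ∸ r)) ⟩
      t ^ (m ∸ k) * (+ 1 * (μ x * t ^ (k ∸ r)))     ≡⟨ cong₂ (λ i p → t ^ (m ∸ k) * (i * (μ x * p)))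
                                                         (sym (indicator-yes all-allowed (atomsBelowIn? (A ∪? []) x)))
                                                         (sym (missing≡t^ A x)) ⟩
      t ^ (m ∸ k) * term A [] x                     ∎
      where
      open ≡-Reasoning
      k = length A
      r = ρ dec A x
      all-allowed : AtomsBelowIn (A ∪ []) x
      all-allowed = All.tabulate (λ a∈A _ → inj₁ a∈A)
      split-exponent : m ∸ r ≡ (m ∸ k) +ℕ (k ∸ r)
      split-exponent = sym (trans (sym (ℕ.+-∸-assoc (m ∸ k) (length-filter (λ y → dec y x) A)))
                                  (cong (_∸ r) (ℕ.m∸n+n≡m k≤m)))
      rearrange : ∀ a b c → a * (b * c) ≡ b * (+ 1 * (a * c))
      rearrange = solve-∀

open import Defs
open import Data.Nat using (ℕ; _∸_)
open import Data.Integer using (ℤ; _*_; _-_; _^_; +_)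
open import Data.List using (List; []; length; map)
open import Data.List.Relation.Unary.All using ([]; tabulate)
open import Relation.Binary using (Decidable)
open import Relation.Binary.PropositionalEquality using (_≡_; cong; module ≡-Reasoning)
open import Data.Product using (proj₁)
open Intervals using (atoms≤longest-chain)
open AtomSums using (sumℤ-cong; sumℤ-*; module AtomExpansion)

proposition13 : (dec : Decidable _≤T_) (n : ℕ) (u v : Bin) →
    InT n u → InT n v → u ≤T v →
    (L : List Bin) → Enumerates (InI u v) L →
    (A : List Bin) → Enumerates (IsAtom u v) A →
    (m : ℕ) → IsLongestChainLength u v m →
    (μ : Bin → ℤ) → IsMobius dec u v L μ →
    (t : ℤ) →
    sumℤ (map (λ x → μ x * t ^ (m ∸ ρ dec A x)) L)
    ≡ t ^ (m ∸ length A) * (t - + 1) ^ length A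
proposition13 dec _ u v _ _ u≤v L L-enum A A-enum m longest μ μ-mobius t = begin
  sumℤ (map (λ x → μ x * t ^ (m ∸ ρ dec A x)) L)
    ≡⟨ sumℤ-cong L (term-A-[] (atoms≤longest-chain u≤v A-enum longest)) ⟩
  sumℤ (map (λ x → t ^ (m ∸ length A) * term A [] x) L)
    ≡⟨ sumℤ-* L (term A []) (t ^ (m ∸ length A)) ⟩
  t ^ (m ∸ length A) * partialSum A []
    ≡⟨ cong (t ^ (m ∸ length A) *_)
         (partialSum≡expected A [] (proj₁ A-enum) (λ _ ()) (tabulate (λ a∈A → a∈A)) []) ⟩
  t ^ (m ∸ length A) * (t - + 1) ^ length A ∎
  where
  open ≡-Reasoning
  open AtomExpansion dec u≤v L-enum A-enum μ-mobius t
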